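{- Let $k\ge 2$, let $a_1,\ldots,a_k$ be relatively prime positive integers, let $j\ge 0$ be an integer, and suppose $\gcd(a_2,\ldots,a_k)=d$. Then $$f_j(a_1,a_2,\ldots,a_k)=d\cdot f_j\!\left(a_1,\frac{a_2}{d},\ldots,\frac{a_k}{d}\right).$$
   Context: A positive representation of an integer $M$ by a $k$-tuple $(b_1,\ldots,b_k)$ of positive integers is a solution $(x_1,\ldots,x_k)\in\mathbb{Z}_{>0}^k$ of $M=\sum_{i=1}^k b_ix_i$. For relatively prime positive integers $b_1,\ldots,b_k$ and an integer $j\ge0$, $f_j(b_1,\ldots,b_k)$ is the greatest integer $M$ having exactly $j$ positive representations by $(b_1,\ldots,b_k)$, if such a positive integer exists, and $f_j(b_1,\ldots,b_k)=0$ otherwise. -}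

module Defs where

open import Data.Nat using (ℕ; zero; suc; _+_; _*_; _≤_; _<_; NonZero)
open import Data.Nat.GCD using (gcd)
open import Data.Nat.DivMod using (_/_)
open import Data.Vec using (Vec; []; _∷_; foldr; zipWith; sum; map)
open import Data.Vec.Relation.Unary.All using (All)
open import Data.Fin using (Fin)
open import Data.Product using (Σ; _×_)
open import Data.Sum using (_⊎_)
open import Function.Bundles using (_↔_)
open import Relation.Binary.PropositionalEquality using (_≡_)
open import Relation.Nullary using (¬_)

Pos : ℕ → Set
Pos n = 0 < n

gcdVec : ∀ {k} → Vec ℕ k → ℕ
gcdVec = foldr _ gcd 0

dot : ∀ {k} → Vec ℕ k → Vec ℕ k → ℕ
dot b x = sum (zipWith _*_ b x)

Rep : ∀ {k} → Vec ℕ k → ℕ → Set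
Rep {k} b M = Σ (Vec ℕ k) (λ x → All Pos x × dot b x ≡ M)

HasExactly : ∀ {k} → ℕ → Vec ℕ k → ℕ → Set
HasExactly j b M = Fin j ↔ Rep b M

-- IsF j b M : M = f_j(b), i.e. M is the greatest positive integer with exactly
-- j positive representations, or M = 0 if there is no such positive integer.
-- (Nonpositive integers never have j ≥ 1 representations, and for j = 0 the
--  paper's convention is f_0 = 0 when no positive integer has 0 representations.)
IsF : ∀ {k} → ℕ → Vec ℕ k → ℕ → Set
IsF j b M =
    (M ≡ 0 × (∀ N → Pos N → ¬ HasExactly j b N))
  ⊎ (Pos M × HasExactly j b M × (∀ N → M < N → ¬ HasExactly j b N))

-- integer division by d, with the (unused) convention x / 0 = 0
divBy : ℕ → ℕ → ℕ
divBy x zero = 0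
divBy x (suc d) = x / suc d

{-# OPTIONS --safe #-}
-- Write A = (a₁, d b₂, …, d bₖ) and C = (a₁, b₂, …, bₖ), so gcd (d, a₁) = 1.
-- For s < d with d ∣ N + a₁ s, the substitution x₁ ↦ (x₁ + s) / d is a
-- bijection between the positive representations of N by A and those of
-- M = (N + a₁ s) / d by C; here N ≤ d M, with equality exactly when d ∣ N.
-- Hence N has as many representations by A as some M ≥ N / d has by C, and
-- d M as many by A as M by C, which makes d f_j(C) the largest number with
-- exactly j representations by A.  That f_j(C) exists at all needs the
-- number of representations to be finite (so the count is decidable) and to
-- exceed j for all large N (so the search for the largest one terminates);
-- the latter comes from the Frobenius-type fact that every large number is a
-- nonnegative combination of C.
module Submission where

open import Defs
open import Data.Nat
open import Data.Nat.Properties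
open import Data.Nat.DivMod using (_/_; _%_; m≡m%n+[m/n]*n; m%n<n; m*[n/m]≡n; m*n/n≡m; /-monoˡ-≤)
open import Data.Nat.Divisibility using (_∣_; divides; ∣-trans; ∣m+n∣m⇒∣n; ∣n⇒∣m*n; m∣m*n; n∣m*n)
open import Data.Nat.GCD using (gcd; gcd-GCD; gcd[m,n]∣m; gcd[m,n]∣n; gcd-comm; gcd[m,n]≡0⇒m≡0; c*gcd[m,n]≡gcd[cm,cn]; module Bézout)
open import Data.Nat.Coprimality using (Coprime; coprime-Bézout; coprime-divisor; gcd≡1⇒coprime)
open import Data.Nat.Induction using (<-rec)
open import Data.Nat.Tactic.RingSolver using (solve-∀)
open import Data.Vec using (Vec; []; _∷_; map; sum; head)
open import Data.Vec.Relation.Unary.All as All using (All; []; _∷_)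
open import Data.Vec.Relation.Unary.All.Properties using (map⁺; map⁻)
open import Data.Fin using (Fin; zero; suc; toℕ)
open import Data.Fin.Properties using (+↔⊎; injective⇒≤; toℕ-injective; toℕ≤pred[n])
open import Data.Fin.Permutation using (↔⇒≡)
open import Data.Product using (Σ; ∃; ∃₂; _×_; _,_; proj₁; proj₂)
open import Data.Sum using (_⊎_; inj₁; inj₂)
open import Data.Sum.Function.Propositional using (_⊎-↔_)
open import Data.Empty using (⊥-elim)
open import Function.Bundles using (_↔_; mk↔ₛ′; Inverse; Injection)
open import Function.Base using (_∘_)
open import Function.Definitions using (Injective)
open import Function.Properties.Inverse using (↔-sym; ↔-trans; ↔⇒↣)
open import Relation.Binary.PropositionalEquality
open import Relation.Nullary using (¬_; Dec; yes; no; contradiction)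

m*n>0⇒n>0 : ∀ m {n} → 0 < m * n → 0 < n
m*n>0⇒n>0 m {zero} m*0>0 = contradiction (*-zeroʳ m) (>⇒≢ m*0>0)
m*n>0⇒n>0 m {suc n} _ = z<s

m*[1+n]+o≡m+[m*n+o] : ∀ m n o → m * suc n + o ≡ m + (m * n + o)
m*[1+n]+o≡m+[m*n+o] m n o = trans (cong (_+ o) (*-suc m n)) (+-assoc m (m * n) o)

dot-map-*ˡ : ∀ {k} c (b x : Vec ℕ k) → dot (map (c *_) b) x ≡ c * dot b x
dot-map-*ˡ c [] [] = sym (*-zeroʳ c)
dot-map-*ˡ c (b₀ ∷ b) (x₀ ∷ x) rewrite dot-map-*ˡ c b x = regroup c b₀ x₀ (dot b x)
  where
  regroup : ∀ c b₀ x₀ D → c * b₀ * x₀ + c * D ≡ c * (b₀ * x₀ + D)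
  regroup = solve-∀

dot-map-*ʳ : ∀ {k} c (b x : Vec ℕ k) → dot b (map (c *_) x) ≡ c * dot b x
dot-map-*ʳ c [] [] = sym (*-zeroʳ c)
dot-map-*ʳ c (b₀ ∷ b) (x₀ ∷ x) rewrite dot-map-*ʳ c b x = regroup c b₀ x₀ (dot b x)
  where
  regroup : ∀ c b₀ x₀ D → b₀ * (c * x₀) + c * D ≡ c * (b₀ * x₀ + D)
  regroup = solve-∀

dot-map-suc : ∀ {k} (b x : Vec ℕ k) → dot b (map suc x) ≡ dot b x + sum b
dot-map-suc [] [] = refl
dot-map-suc (b₀ ∷ b) (x₀ ∷ x) rewrite dot-map-suc b x = regroup b₀ x₀ (dot b x) (sum b)
  where
  regroup : ∀ b₀ x₀ D S → b₀ * suc x₀ + (D + S) ≡ b₀ * x₀ + D + (b₀ + S)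
  regroup = solve-∀

gcdVec-∣ : ∀ {k} (v : Vec ℕ k) → All (gcdVec v ∣_) v
gcdVec-∣ [] = []
gcdVec-∣ (a ∷ v) = gcd[m,n]∣m a (gcdVec v) ∷ All.map (∣-trans (gcd[m,n]∣n a (gcdVec v))) (gcdVec-∣ v)

gcdVec-map-* : ∀ {k} c (v : Vec ℕ k) → gcdVec (map (c *_) v) ≡ c * gcdVec v
gcdVec-map-* c [] = sym (*-zeroʳ c)
gcdVec-map-* c (a ∷ v) rewrite gcdVec-map-* c v = sym (c*gcd[m,n]≡gcd[cm,cn] c a (gcdVec v))

map-*-/-cancel : ∀ {k} d′ {v : Vec ℕ k} → All (suc d′ ∣_) v → map (suc d′ *_) (map (_/ suc d′) v) ≡ v
map-*-/-cancel d′ [] = refl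
map-*-/-cancel d′ (d∣a ∷ d∣v) = cong₂ _∷_ (m*[n/m]≡n d∣a) (map-*-/-cancel d′ d∣v)

gcdVec-divide : ∀ {k} d′ (v : Vec ℕ k) → gcdVec v ≡ suc d′ →
                map (suc d′ *_) (map (_/ suc d′) v) ≡ v × gcdVec (map (_/ suc d′) v) ≡ 1
gcdVec-divide d′ v gcd≡d = v≡d*b , *-cancelˡ-≡ _ 1 (suc d′) d*gcd≡d*1
  where
  v≡d*b = map-*-/-cancel d′ (subst (λ g → All (g ∣_) v) gcd≡d (gcdVec-∣ v))
  d*gcd≡d*1 : suc d′ * gcdVec (map (_/ suc d′) v) ≡ suc d′ * 1
  d*gcd≡d*1 = begin
    suc d′ * gcdVec (map (_/ suc d′) v)        ≡⟨ gcdVec-map-* (suc d′) (map (_/ suc d′) v) ⟨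
    gcdVec (map (suc d′ *_) (map (_/ suc d′) v)) ≡⟨ cong gcdVec v≡d*b ⟩
    gcdVec v                                   ≡⟨ gcd≡d ⟩
    suc d′                                     ≡⟨ *-identityʳ (suc d′) ⟨
    suc d′ * 1                                 ∎
    where open ≡-Reasoning

Rep-≡ : ∀ {k} (b : Vec ℕ k) {N} {r s : Rep b N} → proj₁ r ≡ proj₁ s → r ≡ s
Rep-≡ b {r = x , p , e} {s = .x , q , f} refl =
  cong₂ (λ p q → x , p , q) (All.irrelevant <-irrelevant p q) (≡-irrelevant e f)

Finite : Set → Set
Finite A = ∃ λ n → Fin n ↔ A

Finite-empty : ∀ {A : Set} → ¬ A → Finite A
Finite-empty ¬a = 0 , mk↔ₛ′ (λ ()) (λ a → ⊥-elim (¬a a)) (λ a → ⊥-elim (¬a a)) (λ ())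

Finite-↔ : ∀ {A B : Set} → A ↔ B → Finite A → Finite B
Finite-↔ A↔B (n , Fin↔A) = n , ↔-trans Fin↔A A↔B

Finite-⊎ : ∀ {A B : Set} → Finite A → Finite B → Finite (A ⊎ B)
Finite-⊎ (m , f) (n , g) = m + n , ↔-trans +↔⊎ (f ⊎-↔ g)

Rep-[]-finite : ∀ N → Finite (Rep [] N)
Rep-[]-finite zero = 1 , mk↔ₛ′ (λ _ → [] , [] , refl) (λ _ → zero)
  (λ { ([] , [] , refl) → refl }) (λ { zero → refl })
Rep-[]-finite (suc N) = Finite-empty λ { ([] , [] , ()) }

-- Split on whether the first coordinate is 1 or can be decreased by 1.
Rep-∷-↔ : ∀ {k} b₀ (b : Vec ℕ k) N → Rep (b₀ ∷ b) (b₀ + N) ↔ (Rep b N ⊎ Rep (b₀ ∷ b) N)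
Rep-∷-↔ b₀ b N = mk↔ₛ′ to from to∘from from∘to
  where
  to : Rep (b₀ ∷ b) (b₀ + N) → Rep b N ⊎ Rep (b₀ ∷ b) N
  to (suc zero ∷ x , _ ∷ x>0 , e) =
    inj₁ (x , x>0 , +-cancelˡ-≡ b₀ _ _ (trans (cong (_+ dot b x) (sym (*-identityʳ b₀))) e))
  to (suc (suc x₀) ∷ x , _ ∷ x>0 , e) =
    inj₂ (suc x₀ ∷ x , z<s ∷ x>0 , +-cancelˡ-≡ b₀ _ _ (trans (sym (m*[1+n]+o≡m+[m*n+o] b₀ (suc x₀) _)) e))
  from : Rep b N ⊎ Rep (b₀ ∷ b) N → Rep (b₀ ∷ b) (b₀ + N)
  from (inj₁ (x , x>0 , e)) = 1 ∷ x , z<s ∷ x>0 , cong₂ _+_ (*-identityʳ b₀) e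
  from (inj₂ (x₀ ∷ x , x₀>0 ∷ x>0 , e)) =
    suc x₀ ∷ x , z<s ∷ x>0 , trans (m*[1+n]+o≡m+[m*n+o] b₀ x₀ _) (cong (b₀ +_) e)
  to∘from : ∀ r → to (from r) ≡ r
  to∘from (inj₁ _) = cong inj₁ (Rep-≡ b refl)
  to∘from (inj₂ (suc _ ∷ _ , _ ∷ _ , _)) = cong inj₂ (Rep-≡ (b₀ ∷ b) refl)
  from∘to : ∀ r → from (to r) ≡ r
  from∘to (suc zero ∷ _ , _ ∷ _ , _) = Rep-≡ (b₀ ∷ b) refl
  from∘to (suc (suc _) ∷ _ , _ ∷ _ , _) = Rep-≡ (b₀ ∷ b) refl

Rep-∷-below : ∀ {k} {b₀ N} (b : Vec ℕ k) → N < b₀ → ¬ Rep (b₀ ∷ b) N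
Rep-∷-below b N<b₀ (zero ∷ _ , () ∷ _ , _)
Rep-∷-below {b₀ = b₀} b N<b₀ (suc x₀ ∷ x , _ , e) =
  <⇒≱ N<b₀ (≤-trans (m≤m*n b₀ (suc x₀)) (≤-trans (m≤m+n _ (dot b x)) (≤-reflexive e)))

Rep-finite : ∀ {k} (b : Vec ℕ k) → All Pos b → ∀ N → Finite (Rep b N)
Rep-finite [] [] = Rep-[]-finite
Rep-finite (b₀ ∷ b) (b₀>0 ∷ b>0) = <-rec _ step
  where
  step : ∀ N → (∀ {M} → M < N → Finite (Rep (b₀ ∷ b) M)) → Finite (Rep (b₀ ∷ b) N)
  step N rec with b₀ ≤? N
  ... | no b₀≰N = Finite-empty (Rep-∷-below b (≰⇒> b₀≰N))
  ... | yes b₀≤N with N′ , refl ← m≤n⇒∃[o]m+o≡n b₀≤N =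
    Finite-↔ (↔-sym (Rep-∷-↔ b₀ b N′)) (Finite-⊎ (Rep-finite b b>0 N′) (rec (m<n+m N′ b₀>0)))

HasExactly-dec : ∀ {k} (b : Vec ℕ k) → All Pos b → ∀ j N → Dec (HasExactly j b N)
HasExactly-dec b b>0 j N with n , Fin↔Rep ← Rep-finite b b>0 N with j ≟ n
... | yes refl = yes Fin↔Rep
... | no j≢n = no λ Fin↔Rep′ → j≢n (↔⇒≡ (↔-trans Fin↔Rep′ (↔-sym Fin↔Rep)))

¬HasExactly-distinct : ∀ {k} {b : Vec ℕ k} {j N} (x : Fin (suc j) → Vec ℕ k) → Injective _≡_ _≡_ x →
                       (∀ i → All Pos (x i) × dot b (x i) ≡ N) → ¬ HasExactly j b N
¬HasExactly-distinct {b = b} {j} {N} x x-injective x-rep Fin↔Rep =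
  <-irrefl refl (injective⇒≤ from∘rep-injective)
  where
  rep : Fin (suc j) → Rep b N
  rep i = x i , x-rep i
  from∘rep-injective : Injective _≡_ _≡_ (Inverse.from Fin↔Rep ∘ rep)
  from∘rep-injective = x-injective ∘ cong proj₁ ∘ Injection.injective (↔⇒↣ (↔-sym Fin↔Rep))

IsF-search : ∀ {k} (b : Vec ℕ k) {j} → (∀ N → Dec (HasExactly j b N)) →
             ∀ B → (∀ N → B ≤ N → ¬ HasExactly j b N) → Σ ℕ (IsF j b)
IsF-search b dec zero none = 0 , inj₁ (refl , λ N _ → none N z≤n)
IsF-search b {j} dec (suc B) none with dec B
... | no ¬B = IsF-search b dec B none′
  where
  none′ : ∀ N → B ≤ N → ¬ HasExactly j b N
  none′ N B≤N with m≤n⇒m<n∨m≡n B≤N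
  ... | inj₁ B<N = none N B<N
  ... | inj₂ refl = ¬B
IsF-search b dec (suc zero) none | yes _ = 0 , inj₁ (refl , none)
IsF-search b dec (suc (suc B)) none | yes hB = suc B , inj₂ (z<s , hB , none)

dot-Bézout : ∀ {k} (v : Vec ℕ k) n → ∃₂ λ w t → dot v w ≡ gcdVec v + suc n * t
dot-Bézout [] n = [] , 0 , sym (*-zeroʳ (suc n))
dot-Bézout (v₀ ∷ v) n with w , t , e ← dot-Bézout v n with Bézout.identity (gcd-GCD v₀ (gcdVec v))
... | Bézout.+- x y g+yG≡xv₀ = x ∷ map (n * y *_) w , y * G + n * y * t , (begin
    v₀ * x + dot v (map (n * y *_) w) ≡⟨ cong₂ _+_ (*-comm v₀ x) (dot-map-*ʳ (n * y) v w) ⟩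
    x * v₀ + n * y * dot v w          ≡⟨ cong₂ (λ u D → u + n * y * D) (sym g+yG≡xv₀) e ⟩
    g + y * G + n * y * (G + suc n * t) ≡⟨ regroup g y G n t ⟩
    g + suc n * (y * G + n * y * t)   ∎)
  where
  open ≡-Reasoning
  G = gcdVec v
  g = gcd v₀ G
  regroup : ∀ g y G n t → g + y * G + n * y * (G + suc n * t) ≡ g + suc n * (y * G + n * y * t)
  regroup = solve-∀
... | Bézout.-+ x y g+xv₀≡yG = n * x ∷ map (y *_) w , x * v₀ + y * t , (begin
    v₀ * (n * x) + dot v (map (y *_) w) ≡⟨ cong (v₀ * (n * x) +_) (dot-map-*ʳ y v w) ⟩
    v₀ * (n * x) + y * dot v w          ≡⟨ cong (λ D → v₀ * (n * x) + y * D) e ⟩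
    v₀ * (n * x) + y * (G + suc n * t)  ≡⟨ regroup₁ v₀ n x y G t ⟩
    v₀ * (n * x) + y * G + suc n * (y * t) ≡⟨ cong (λ u → v₀ * (n * x) + u + suc n * (y * t)) (sym g+xv₀≡yG) ⟩
    v₀ * (n * x) + (g + x * v₀) + suc n * (y * t) ≡⟨ regroup₂ g v₀ n x y t ⟩
    g + suc n * (x * v₀ + y * t)        ∎)
  where
  open ≡-Reasoning
  G = gcdVec v
  g = gcd v₀ G
  regroup₁ : ∀ v₀ n x y G t → v₀ * (n * x) + y * (G + suc n * t) ≡ v₀ * (n * x) + y * G + suc n * (y * t)
  regroup₁ = solve-∀
  regroup₂ : ∀ g v₀ n x y t → v₀ * (n * x) + (g + x * v₀) + suc n * (y * t) ≡ g + suc n * (x * v₀ + y * t)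
  regroup₂ = solve-∀

-- Write N = ρ + a Q with ρ < a and use dot b w = 1 + a t: then
-- N = a (Q ∸ ρ t) + dot b (ρ w), where ρ t ≤ Q once N ≥ a (a t).
large-representable : ∀ {k} a′ (b : Vec ℕ k) → gcdVec b ≡ 1 →
                      ∃ λ B → ∀ N → B ≤ N → ∃ λ z → dot (suc a′ ∷ b) z ≡ N
large-representable a′ b gcd≡1 with w , t , e ← dot-Bézout b a′ =
  a * (a * t) , λ N B≤N → (N / a ∸ N % a * t) ∷ map (N % a *_) w , representation N B≤N
  where
  a = suc a′
  representation : ∀ N → a * (a * t) ≤ N → a * (N / a ∸ N % a * t) + dot b (map (N % a *_) w) ≡ N
  representation N B≤N = begin
    a * r + dot b (map (ρ *_) w)  ≡⟨ cong (a * r +_) (dot-map-*ʳ ρ b w) ⟩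
    a * r + ρ * dot b w           ≡⟨ cong (λ D → a * r + ρ * D) (trans e (cong (_+ a * t) gcd≡1)) ⟩
    a * r + ρ * (1 + a * t)       ≡⟨ regroup a r ρ t ⟩
    ρ + (ρ * t + r) * a           ≡⟨ cong (λ q → ρ + q * a) (m+[n∸m]≡n ρt≤Q) ⟩
    ρ + Q * a                     ≡⟨ m≡m%n+[m/n]*n N a ⟨
    N                             ∎
    where
    open ≡-Reasoning
    ρ = N % a
    Q = N / a
    r = Q ∸ ρ * t
    ρt≤Q : ρ * t ≤ Q
    ρt≤Q = ≤-trans (*-monoˡ-≤ t (<⇒≤ (m%n<n N a)))
                   (subst (_≤ Q) (trans (cong (_/ a) (*-comm a (a * t))) (m*n/n≡m (a * t) a)) (/-monoˡ-≤ a B≤N))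
    regroup : ∀ a r ρ t → a * r + ρ * (1 + a * t) ≡ ρ + (ρ * t + r) * a
    regroup = solve-∀

dot-spread : ∀ {k} a b₂ (b : Vec ℕ k) z₁ z₂ (z : Vec ℕ k) I R →
             dot (a ∷ b₂ ∷ b) ((z₁ + I * b₂) ∷ (z₂ + R * a) ∷ z) ≡ dot (a ∷ b₂ ∷ b) (z₁ ∷ z₂ ∷ z) + (I + R) * (a * b₂)
dot-spread a b₂ b z₁ z₂ z I R = regroup a z₁ I b₂ z₂ R (dot b z)
  where
  regroup : ∀ a z₁ I b₂ z₂ R D →
            a * (z₁ + I * b₂) + (b₂ * (z₂ + R * a) + D) ≡ a * z₁ + (b₂ * z₂ + D) + (I + R) * (a * b₂)
  regroup = solve-∀

-- Above a representable number, shifting i · b₂ from the second coordinate to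
-- the first (i ≤ j) gives j + 1 distinct positive representations.
¬HasExactly-spread : ∀ {k} j a b₂ (b : Vec ℕ k) (z : Vec ℕ (2 + k)) {N} → 0 < b₂ →
                     dot (a ∷ b₂ ∷ b) z + j * (a * b₂) + sum (a ∷ b₂ ∷ b) ≡ N →
                     ¬ HasExactly j (a ∷ b₂ ∷ b) N
¬HasExactly-spread {k} j a b₂ b (z₁ ∷ z₂ ∷ z) {N} b₂>0 eq = ¬HasExactly-distinct x x-injective x-rep
  where
  c = a ∷ b₂ ∷ b
  x : Fin (suc j) → Vec ℕ (2 + k)
  x i = map suc ((z₁ + toℕ i * b₂) ∷ (z₂ + (j ∸ toℕ i) * a) ∷ z)
  x-injective : Injective _≡_ _≡_ x
  x-injective {i} {i′} xi≡xi′ =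
    toℕ-injective (*-cancelʳ-≡ (toℕ i) (toℕ i′) b₂ {{>-nonZero b₂>0}}
      (+-cancelˡ-≡ z₁ _ _ (suc-injective (cong head xi≡xi′))))
  x-rep : ∀ i → All Pos (x i) × dot c (x i) ≡ N
  x-rep i = map⁺ (All.universal (λ _ → z<s) y) , (begin
    dot c (map suc y)                                      ≡⟨ dot-map-suc c y ⟩
    dot c y + sum c                                        ≡⟨ cong (_+ sum c) (dot-spread a b₂ b z₁ z₂ z I (j ∸ I)) ⟩
    dot c (z₁ ∷ z₂ ∷ z) + (I + (j ∸ I)) * (a * b₂) + sum c ≡⟨ cong (λ n → dot c (z₁ ∷ z₂ ∷ z) + n * (a * b₂) + sum c) I+[j∸I]≡j ⟩
    dot c (z₁ ∷ z₂ ∷ z) + j * (a * b₂) + sum c             ≡⟨ eq ⟩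
    N                                                      ∎)
    where
    open ≡-Reasoning
    I = toℕ i
    y = (z₁ + I * b₂) ∷ (z₂ + (j ∸ I) * a) ∷ z
    I+[j∸I]≡j : I + (j ∸ I) ≡ j
    I+[j∸I]≡j = m+[n∸m]≡n (toℕ≤pred[n] i)

¬HasExactly-large : ∀ {k} j a′ (b : Vec ℕ (suc k)) → All Pos b → gcdVec b ≡ 1 →
                    ∃ λ B → ∀ N → B ≤ N → ¬ HasExactly j (suc a′ ∷ b) N
¬HasExactly-large j a′ (b₂ ∷ b) (b₂>0 ∷ _) gcd≡1 = B + K , none
  where
  c = suc a′ ∷ b₂ ∷ b
  K = j * (suc a′ * b₂) + sum c
  B = proj₁ (large-representable a′ (b₂ ∷ b) gcd≡1)
  representable = proj₂ (large-representable a′ (b₂ ∷ b) gcd≡1)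
  none : ∀ N → B + K ≤ N → ¬ HasExactly j c N
  none N B+K≤N =
    let z , z-rep = representable (N ∸ K) (m+n≤o⇒m≤o∸n B B+K≤N)
    in ¬HasExactly-spread j (suc a′) b₂ b z b₂>0 (begin
      dot c z + j * (suc a′ * b₂) + sum c ≡⟨ +-assoc (dot c z) (j * (suc a′ * b₂)) (sum c) ⟩
      dot c z + K                         ≡⟨ cong (_+ K) z-rep ⟩
      N ∸ K + K                           ≡⟨ m∸n+n≡m (m+n≤o⇒n≤o B B+K≤N) ⟩
      N                                   ∎)
    where open ≡-Reasoning

coprime⇒∣1+* : ∀ {d′ a} → Coprime (suc d′) a → ∃ λ u → suc d′ ∣ 1 + a * u
coprime⇒∣1+* {d′} {a} coprime with coprime-Bézout coprime
... | Bézout.+- x y 1+ya≡xd = y , divides x (trans (cong suc (*-comm a y)) 1+ya≡xd)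
... | Bézout.-+ x y 1+xd≡ya = d′ * y , divides (1 + d′ * x) (begin
    1 + a * (d′ * y)            ≡⟨ regroup₁ a d′ y ⟩
    1 + d′ * (y * a)            ≡⟨ cong (λ n → 1 + d′ * n) 1+xd≡ya ⟨
    1 + d′ * (1 + x * suc d′)   ≡⟨ regroup₂ d′ x ⟩
    (1 + d′ * x) * suc d′       ∎)
  where
  open ≡-Reasoning
  regroup₁ : ∀ a d′ y → 1 + a * (d′ * y) ≡ 1 + d′ * (y * a)
  regroup₁ = solve-∀
  regroup₂ : ∀ d′ x → 1 + d′ * (1 + x * suc d′) ≡ (1 + d′ * x) * suc d′
  regroup₂ = solve-∀

∣+*%-reduce : ∀ d .{{_ : NonZero d}} N a P → d ∣ N + a * P → d ∣ N + a * (P % d)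
∣+*%-reduce d N a P d∣N+aP = ∣m+n∣m⇒∣n (subst (d ∣_) split d∣N+aP) (∣n⇒∣m*n a (n∣m*n (P / d)))
  where
  split : N + a * P ≡ a * (P / d * d) + (N + a * (P % d))
  split = begin
    N + a * P                          ≡⟨ cong (λ n → N + a * n) (m≡m%n+[m/n]*n P d) ⟩
    N + a * (P % d + P / d * d)        ≡⟨ regroup N a (P % d) (P / d * d) ⟩
    a * (P / d * d) + (N + a * (P % d)) ∎
    where
    open ≡-Reasoning
    regroup : ∀ N a s q → N + a * (s + q) ≡ a * q + (N + a * s)
    regroup = solve-∀

-- With d ∣ 1 + a u, the number N + a (N u) = N (1 + a u) is a multiple of d.
coprime⇒residue : ∀ {d′ a} → Coprime (suc d′) a → ∀ N → ∃ λ s → s < suc d′ × suc d′ ∣ N + a * s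
coprime⇒residue {d′} {a} coprime N =
  let u , d∣1+au = coprime⇒∣1+* coprime
  in N * u % suc d′ , m%n<n (N * u) (suc d′) ,
     ∣+*%-reduce (suc d′) N a (N * u) (subst (suc d′ ∣_) (regroup N a u) (∣n⇒∣m*n N d∣1+au))
  where
  regroup : ∀ N a u → N * (1 + a * u) ≡ N + a * (N * u)
  regroup = solve-∀

module Scaling (a d′ : ℕ) {k} (b : Vec ℕ k) (coprime : Coprime (suc d′) a) where

  private
    d : ℕ
    d = suc d′

  s<d*y : ∀ {s y} → s < d → 0 < y → s < d * y
  s<d*y {y = y} s<d y>0 = <-≤-trans s<d (m≤m*n d y {{>-nonZero y>0}})

  module Shift {s N M} (s<d : s < d) (dM≡N+as : d * M ≡ N + a * s) where

    open ≡-Reasoning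

    multiple : ∀ x₁ x → a * x₁ + dot (map (d *_) b) x ≡ N → d * dot b x + a * (x₁ + s) ≡ d * M
    multiple x₁ x e = begin
      d * dot b x + a * (x₁ + s)            ≡⟨ regroup (d * dot b x) a x₁ s ⟩
      a * x₁ + d * dot b x + a * s          ≡⟨ cong (λ D → a * x₁ + D + a * s) (dot-map-*ˡ d b x) ⟨
      a * x₁ + dot (map (d *_) b) x + a * s ≡⟨ cong (_+ a * s) e ⟩
      N + a * s                             ≡⟨ dM≡N+as ⟨
      d * M                                 ∎
      where
      regroup : ∀ dD a x₁ s → dD + a * (x₁ + s) ≡ a * x₁ + dD + a * s
      regroup = solve-∀

    divisible : ∀ x₁ x → a * x₁ + dot (map (d *_) b) x ≡ N → d ∣ x₁ + s
    divisible x₁ x e =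
      coprime-divisor coprime (∣m+n∣m⇒∣n (subst (d ∣_) (sym (multiple x₁ x e)) (m∣m*n M)) (m∣m*n (dot b x)))

    to : Rep (a ∷ map (d *_) b) N → Rep (a ∷ b) M
    to (x₁ ∷ x , x₁>0 ∷ x>0 , e) = y₁ ∷ x , y₁>0 ∷ x>0 , *-cancelˡ-≡ _ M d (begin
      d * (a * y₁ + dot b x)     ≡⟨ regroup d a y₁ (dot b x) ⟩
      d * dot b x + a * (d * y₁) ≡⟨ cong (λ n → d * dot b x + a * n) d*y₁≡x₁+s ⟩
      d * dot b x + a * (x₁ + s) ≡⟨ multiple x₁ x e ⟩
      d * M                      ∎)
      where
      y₁ = (x₁ + s) / d
      d*y₁≡x₁+s : d * y₁ ≡ x₁ + s
      d*y₁≡x₁+s = m*[n/m]≡n (divisible x₁ x e)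
      y₁>0 : 0 < y₁
      y₁>0 = m*n>0⇒n>0 d (subst (0 <_) (sym d*y₁≡x₁+s) (<-≤-trans x₁>0 (m≤m+n x₁ s)))
      regroup : ∀ d a y D → d * (a * y + D) ≡ d * D + a * (d * y)
      regroup = solve-∀

    from : Rep (a ∷ b) M → Rep (a ∷ map (d *_) b) N
    from (y₁ ∷ x , y₁>0 ∷ x>0 , e) = d * y₁ ∸ s ∷ x , m<n⇒0<n∸m (s<d*y s<d y₁>0) ∷ x>0 ,
      +-cancelʳ-≡ (a * s) _ N (begin
      a * (d * y₁ ∸ s) + dot (map (d *_) b) x + a * s ≡⟨ cong (λ D → a * (d * y₁ ∸ s) + D + a * s) (dot-map-*ˡ d b x) ⟩
      a * (d * y₁ ∸ s) + d * dot b x + a * s          ≡⟨ regroup₁ a (d * y₁ ∸ s) (d * dot b x) s ⟩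
      a * (d * y₁ ∸ s + s) + d * dot b x              ≡⟨ cong (λ n → a * n + d * dot b x) (m∸n+n≡m (<⇒≤ (s<d*y s<d y₁>0))) ⟩
      a * (d * y₁) + d * dot b x                      ≡⟨ regroup₂ a d y₁ (dot b x) ⟩
      d * (a * y₁ + dot b x)                          ≡⟨ cong (d *_) e ⟩
      d * M                                           ≡⟨ dM≡N+as ⟩
      N + a * s                                       ∎)
      where
      regroup₁ : ∀ a X dD s → a * X + dD + a * s ≡ a * (X + s) + dD
      regroup₁ = solve-∀
      regroup₂ : ∀ a d y D → a * (d * y) + d * D ≡ d * (a * y + D)
      regroup₂ = solve-∀

    to∘from : ∀ r → to (from r) ≡ r
    to∘from (y₁ ∷ x , y₁>0 ∷ _ , _) = Rep-≡ (a ∷ b) (cong (_∷ x) (begin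
      (d * y₁ ∸ s + s) / d ≡⟨ cong (_/ d) (m∸n+n≡m (<⇒≤ (s<d*y s<d y₁>0))) ⟩
      d * y₁ / d           ≡⟨ cong (_/ d) (*-comm d y₁) ⟩
      y₁ * d / d           ≡⟨ m*n/n≡m y₁ d ⟩
      y₁                   ∎))

    from∘to : ∀ r → from (to r) ≡ r
    from∘to (x₁ ∷ x , _ ∷ _ , e) = Rep-≡ (a ∷ map (d *_) b) (cong (_∷ x)
      (trans (cong (_∸ s) (m*[n/m]≡n (divisible x₁ x e))) (m+n∸n≡m x₁ s)))

  Rep-shift-↔ : ∀ {s N M} → s < d → d * M ≡ N + a * s → Rep (a ∷ map (d *_) b) N ↔ Rep (a ∷ b) M
  Rep-shift-↔ s<d dM≡N+as = mk↔ₛ′ to from to∘from from∘to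
    where open Shift s<d dM≡N+as

  Rep-scale-↔ : ∀ M → Rep (a ∷ map (d *_) b) (d * M) ↔ Rep (a ∷ b) M
  Rep-scale-↔ M = Rep-shift-↔ z<s (sym (trans (cong (d * M +_) (*-zeroʳ a)) (+-identityʳ (d * M))))

  Rep-reduce-↔ : ∀ N → ∃ λ M → N ≤ d * M × (Rep (a ∷ map (d *_) b) N ↔ Rep (a ∷ b) M)
  Rep-reduce-↔ N =
    let s , s<d , d∣N+as = coprime⇒residue coprime N
        d*M≡N+as = m*[n/m]≡n d∣N+as
    in (N + a * s) / d , subst (N ≤_) (sym d*M≡N+as) (m≤m+n N (a * s)) , Rep-shift-↔ s<d d*M≡N+as

  IsF-scale : ∀ {j M} → IsF j (a ∷ b) M → IsF j (a ∷ map (d *_) b) (d * M)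
  IsF-scale (inj₁ (refl , none)) = inj₁ (*-zeroʳ d , λ N N>0 hN →
    let M , N≤dM , N↔M = Rep-reduce-↔ N
    in none M (m*n>0⇒n>0 d (<-≤-trans N>0 N≤dM)) (↔-trans hN N↔M))
  IsF-scale {M = M} (inj₂ (z<s , hM , none)) = inj₂ (z<s , ↔-trans hM (↔-sym (Rep-scale-↔ M)) , λ N dM<N hN →
    let M′ , N≤dM′ , N↔M′ = Rep-reduce-↔ N
    in none M′ (*-cancelˡ-< d M M′ (<-≤-trans dM<N N≤dM′)) (↔-trans hN N↔M′))

theorem2 : (m : ℕ) (j : ℕ) (a₁ : ℕ) (as : Vec ℕ (suc m)) (d : ℕ) →
    Pos a₁ → All Pos as → gcdVec (a₁ ∷ as) ≡ 1 → gcdVec as ≡ d →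
    Σ ℕ (λ M → IsF j (a₁ ∷ map (λ x → divBy x d) as) M × IsF j (a₁ ∷ as) (d * M))
theorem2 m j a₁ (a ∷ _) zero _ (a>0 ∷ _) _ gcd≡0 = contradiction (gcd[m,n]≡0⇒m≡0 gcd≡0) (>⇒≢ a>0)
theorem2 m j zero as (suc d′) () _ _ _
theorem2 m j (suc a′) as (suc d′) _ as>0 gcd≡1 gcd≡d =
  M , isF , subst (λ v → IsF j (suc a′ ∷ v) (suc d′ * M)) as≡d*b (Scaling.IsF-scale (suc a′) d′ b coprime isF)
  where
  b = map (_/ suc d′) as
  as≡d*b = proj₁ (gcdVec-divide d′ as gcd≡d)
  b>0 : All Pos b
  b>0 = All.map (m*n>0⇒n>0 (suc d′)) (map⁻ (subst (All Pos) (sym as≡d*b) as>0))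
  coprime : Coprime (suc d′) (suc a′)
  coprime = gcd≡1⇒coprime (trans (gcd-comm (suc d′) (suc a′)) (trans (cong (gcd (suc a′)) (sym gcd≡d)) gcd≡1))
  bound = ¬HasExactly-large j a′ b b>0 (proj₂ (gcdVec-divide d′ as gcd≡d))
  found : Σ ℕ (IsF j (suc a′ ∷ b))
  found = IsF-search (suc a′ ∷ b) (HasExactly-dec (suc a′ ∷ b) (z<s ∷ b>0) j) (proj₁ bound) (proj₂ bound)
  M = proj₁ found
  isF = proj₂ found
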